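{- Let $\mathcal{H}$ be a strongly connected $d$-uniform hypergraph. Then any two distinct exact transversals of $\mathcal{H}$ are disjoint.
   Context: A $d$-uniform hypergraph consists of a vertex set and a family of edges, each a $d$-element subset of the vertex set. $\mathcal{H}$ is strongly connected if for every pair of edges $e,f$ there is a finite sequence of edges $e=e^{(0)},e^{(1)},\dots,e^{(n)}=f$ in which consecutive edges have symmetric difference of cardinality two. An exact transversal of $\mathcal{H}$ is a set of vertices meeting each edge in exactly one vertex. -}

module Defs where

open import Level using (Level; _⊔_; suc)
open import Data.Nat using (ℕ)
open import Data.List using (List; length)
open import Data.List.Membership.Propositional using (_∈_; _∉_)
open import Data.List.Relation.Unary.Unique.Propositional using (Unique)
open import Data.Product using (Σ; _×_; ∃)
open import Data.Sum using (_⊎_)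
open import Data.Empty using (⊥)
open import Relation.Nullary using (¬_)
open import Relation.Binary.PropositionalEquality using (_≡_)
open import Function.Bundles using (_⇔_)

-- A d-uniform hypergraph on vertex type V: a family of edges indexed by E,
-- each edge a finite d-element set of vertices, presented as a duplicate-free list
-- of length d (the list order is irrelevant to all notions below).
record UniformHypergraph {a b : Level} (V : Set a) (d : ℕ) : Set (a ⊔ suc b) where
  field
    Edge      : Set b
    verts     : Edge → List V
    unique    : ∀ e → Unique (verts e)
    uniform   : ∀ e → length (verts e) ≡ d

module _ {a b : Level} {V : Set a} {d : ℕ} (H : UniformHypergraph {a} {b} V d) where
  open UniformHypergraph H

  SymDiffCard2 : Edge → Edge → Set a
  SymDiffCard2 e f =
    Σ (List V) λ L → Unique L × length L ≡ 2 ×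
      (∀ x → x ∈ L ⇔ ((x ∈ verts e × x ∉ verts f) ⊎ (x ∈ verts f × x ∉ verts e)))

  data Walk : Edge → Edge → Set (a ⊔ b) where
    here : ∀ {e} → Walk e e
    step : ∀ {e g f} → SymDiffCard2 e g → Walk g f → Walk e f

  StronglyConnected : Set (a ⊔ b)
  StronglyConnected = ∀ e f → Walk e f

  -- every vertex lies in some edge (vertex set = union of edges)
  NoIsolatedVertices : Set (a ⊔ b)
  NoIsolatedVertices = ∀ (x : V) → ∃ λ e → x ∈ verts e

  ExactTransversal : (V → Set a) → Set (a ⊔ b)
  ExactTransversal T =
    ∀ e → Σ V λ x → x ∈ verts e × T x × (∀ y → y ∈ verts e → T y → y ≡ x)

SameSet : ∀ {a} {V : Set a} → (V → Set a) → (V → Set a) → Set a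
SameSet S T = ∀ x → S x ⇔ T x

Disjoint : ∀ {a} {V : Set a} → (V → Set a) → (V → Set a) → Set a
Disjoint S T = ∀ x → S x → T x → ⊥

module Submission where

-- Write s(e), t(e) for the unique vertex of the edge e lying in S, resp. T,
-- and say that e is an agreeing edge when s(e) = t(e).
--  * An edge containing a vertex of S ∩ T is agreeing (uniqueness of s, t).
--  * Agreement propagates along a step e → g with |e Δ g| = 2: if z = s(e) = t(e)
--    but s(g) ≠ t(g), then z ∉ g, hence s(g), t(g) ∉ e, so z, s(g), t(g) are
--    three distinct elements of the two-element set e Δ g.
--  * By strong connectivity, one agreeing edge makes every edge agreeing, and
--    since every vertex lies in an edge, S and T then coincide.
-- So if S and T share a vertex they are equal, which is the contrapositive of
-- the theorem.

open import Defs
open import Level using (Level)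
open import Data.Nat using (ℕ)
open import Data.List using (List; []; _∷_; length)
open import Data.List.Membership.Propositional using (_∈_; _∉_)
open import Data.List.Relation.Unary.Any using (here; there)
open import Data.List.Relation.Unary.All as All using ()
open import Data.List.Relation.Unary.AllPairs using (_∷_)
open import Data.List.Relation.Unary.Unique.Propositional using (Unique)
open import Data.Product using (_,_; proj₁; proj₂)
open import Data.Sum using (_⊎_; inj₁; inj₂)
open import Data.Empty using (⊥; ⊥-elim)
open import Relation.Nullary using (¬_; Dec; yes; no)
open import Relation.Binary.PropositionalEquality using (_≡_; refl; sym; trans; subst)
open import Function.Bundles using (Equivalence; mk⇔)

-- Equality is decidable between members of a duplicate-free list: they are
-- equal exactly when they occupy the same position.
≟-∈-unique : ∀ {a} {A : Set a} {xs : List A} {x y : A} →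
             Unique xs → x ∈ xs → y ∈ xs → Dec (x ≡ y)
≟-∈-unique _        (here x≡z) (here y≡z) = yes (trans x≡z (sym y≡z))
≟-∈-unique (z∉ ∷ _) (here x≡z) (there y∈) =
  no λ x≡y → All.lookup z∉ (subst (_∈ _) (trans (sym x≡y) x≡z) y∈) refl
≟-∈-unique (z∉ ∷ _) (there x∈) (here y≡z) =
  no λ x≡y → All.lookup z∉ (subst (_∈ _) (trans x≡y y≡z) x∈) refl
≟-∈-unique (_ ∷ u)  (there x∈) (there y∈) = ≟-∈-unique u x∈ y∈

no-three-distinct : ∀ {a} {A : Set a} {L : List A} {x y z : A} → length L ≡ 2 →
                    x ∈ L → y ∈ L → z ∈ L → ¬ x ≡ y → ¬ y ≡ z → ¬ x ≡ z → ⊥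
no-three-distinct {L = p ∷ q ∷ []} refl x∈ y∈ z∈ x≢y y≢z x≢z
  with one-of x∈ | one-of y∈ | one-of z∈
  where
  one-of : ∀ {w} → w ∈ p ∷ q ∷ [] → w ≡ p ⊎ w ≡ q
  one-of (here w≡p)         = inj₁ w≡p
  one-of (there (here w≡q)) = inj₂ w≡q
... | inj₁ x≡p | inj₁ y≡p | _        = x≢y (trans x≡p (sym y≡p))
... | inj₂ x≡q | inj₂ y≡q | _        = x≢y (trans x≡q (sym y≡q))
... | inj₁ x≡p | inj₂ _   | inj₁ z≡p = x≢z (trans x≡p (sym z≡p))
... | inj₁ _   | inj₂ y≡q | inj₂ z≡q = y≢z (trans y≡q (sym z≡q))
... | inj₂ _   | inj₁ y≡p | inj₁ z≡p = y≢z (trans y≡p (sym z≡p))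
... | inj₂ x≡q | inj₁ _   | inj₂ z≡q = x≢z (trans x≡q (sym z≡q))

module Transversal {a b : Level} {V : Set a} {d : ℕ} (H : UniformHypergraph {a} {b} V d)
  {S : V → Set a} (exact : ExactTransversal H S) where
  open UniformHypergraph H

  rep : Edge → V
  rep e = proj₁ (exact e)

  rep-∈ : ∀ e → rep e ∈ verts e
  rep-∈ e = proj₁ (proj₂ (exact e))

  rep-S : ∀ e → S (rep e)
  rep-S e = proj₁ (proj₂ (proj₂ (exact e)))

  rep-unique : ∀ e {y} → y ∈ verts e → S y → y ≡ rep e
  rep-unique e y∈e Sy = proj₂ (proj₂ (proj₂ (exact e))) _ y∈e Sy

  -- If the representative of e avoids g, the representative of g avoids e:
  -- were rep g ∈ e, it would equal rep e, which lies outside g.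
  rep-avoids : ∀ e g → rep e ∉ verts g → rep g ∉ verts e
  rep-avoids e g rep-e∉g rep-g∈e =
    rep-e∉g (subst (_∈ verts g) (rep-unique e rep-g∈e (rep-S g)) (rep-∈ g))

module Agreement {a b : Level} {V : Set a} {d : ℕ} (H : UniformHypergraph {a} {b} V d)
  {S T : V → Set a} (exact-S : ExactTransversal H S) (exact-T : ExactTransversal H T) where
  open UniformHypergraph H
  open Transversal H exact-S renaming
    (rep to s; rep-∈ to s-∈; rep-S to s-S; rep-unique to s-unique; rep-avoids to s-avoids)
  open Transversal H exact-T renaming
    (rep to t; rep-∈ to t-∈; rep-S to t-T; rep-unique to t-unique; rep-avoids to t-avoids)

  Agrees : Edge → Set a
  Agrees e = s e ≡ t e

  common-vertex-agrees : ∀ e {x} → x ∈ verts e → S x → T x → Agrees e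
  common-vertex-agrees e x∈e Sx Tx = trans (sym (s-unique e x∈e Sx)) (t-unique e x∈e Tx)

  ∉-≢-∈ : ∀ g {x y} → x ∉ verts g → y ∈ verts g → ¬ x ≡ y
  ∉-≢-∈ g x∉g y∈g x≡y = x∉g (subst (_∈ verts g) (sym x≡y) y∈g)

  agrees-step : ∀ e g → SymDiffCard2 H e g → Agrees e → Agrees g
  agrees-step e g (L , _ , length≡2 , ∈L⇔) s≡t with ≟-∈-unique (unique g) (s-∈ g) (t-∈ g)
  ... | yes sg≡tg = sg≡tg
  ... | no  sg≢tg =
    ⊥-elim (no-three-distinct length≡2 (in-Δ-from-e (s-∈ e) s-e∉g)
                                       (in-Δ-from-g (s-∈ g) (s-avoids e g s-e∉g))
                                       (in-Δ-from-g (t-∈ g) (t-avoids e g t-e∉g))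
                                       (∉-≢-∈ g s-e∉g (s-∈ g)) sg≢tg (∉-≢-∈ g s-e∉g (t-∈ g)))
    where
    s-e∉g : s e ∉ verts g
    s-e∉g s-e∈g = sg≢tg (common-vertex-agrees g s-e∈g (s-S e) (subst T (sym s≡t) (t-T e)))
    t-e∉g : t e ∉ verts g
    t-e∉g = subst (_∉ verts g) s≡t s-e∉g
    in-Δ-from-e : ∀ {x} → x ∈ verts e → x ∉ verts g → x ∈ L
    in-Δ-from-e x∈e x∉g = Equivalence.from (∈L⇔ _) (inj₁ (x∈e , x∉g))
    in-Δ-from-g : ∀ {x} → x ∈ verts g → x ∉ verts e → x ∈ L
    in-Δ-from-g x∈g x∉e = Equivalence.from (∈L⇔ _) (inj₂ (x∈g , x∉e))

  agrees-walk : ∀ {e f} → Walk H e f → Agrees e → Agrees f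
  agrees-walk here               agrees = agrees
  agrees-walk (step {e} {g} Δ w) agrees = agrees-walk w (agrees-step e g Δ agrees)

  all-agree⇒same : NoIsolatedVertices H → (∀ e → Agrees e) → SameSet S T
  all-agree⇒same covered agree y with covered y
  ... | e , y∈e = mk⇔
    (λ Sy → subst T (sym (trans (s-unique e y∈e Sy) (agree e))) (t-T e))
    (λ Ty → subst S (sym (trans (t-unique e y∈e Ty) (sym (agree e)))) (s-S e))

  common-vertex⇒same : NoIsolatedVertices H → StronglyConnected H →
                       ∀ x → S x → T x → SameSet S T
  common-vertex⇒same covered connected x Sx Tx with covered x
  ... | e₀ , x∈e₀ = all-agree⇒same covered λ e →
    agrees-walk (connected e₀ e) (common-vertex-agrees e₀ x∈e₀ Sx Tx)

theorem4p1 : ∀ {a b : Level} {V : Set a} {d : ℕ} (H : UniformHypergraph {a} {b} V d) →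
    NoIsolatedVertices H → StronglyConnected H →
    (S T : V → Set a) → ExactTransversal H S → ExactTransversal H T →
    ¬ SameSet S T → Disjoint S T
theorem4p1 H covered connected S T exact-S exact-T S≠T x Sx Tx =
  S≠T (Agreement.common-vertex⇒same H exact-S exact-T covered connected x Sx Tx)
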